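{- Let $p:\mathbb{D}\to\mathbb{B}$ and $q:\mathbb{E}\to\mathbb{B}$ be Grothendieck fibrations, suppose $\mathbb{B}$ has pullbacks, and let $\chi:\mathbb{D}\to\mathbb{E}$ be a fibred functor that creates cartesian lifts. If $X\in\mathbb{E}_I$ and the presheaf $\bar\chi_X$ is representable, then for every $\sigma:J\to I$ the presheaf $\bar\chi_{\sigma^\ast(X)}$ is representable. Moreover, if $\bar\chi_X$ is represented by $\tau:K\to I$ in $\mathbb{B}/I$, then $\bar\chi_{\sigma^\ast(X)}$ is represented by the pullback $\sigma^\ast(\tau):J\times_I K\to J$ in $\mathbb{B}/J$.
   Context: Fibrations are cloven, with chosen reindexing $\sigma^\ast$. $\operatorname{Cart}(\mathbb{D})$ denotes the wide subcategory of cartesian maps. $\chi$ creates cartesian lifts if its restriction $\operatorname{Cart}(\chi):\operatorname{Cart}(\mathbb{D})\to\operatorname{Cart}(\mathbb{E})$ is a discrete fibration (for each cartesian $u:X'\to\chi(D)$ there is a unique cartesian map into $D$ sent to $u$). For $X\in\mathbb{E}$, $\bar\chi_X$ is the presheaf on $\mathbb{B}/q(X)$ sending $\sigma:I'\to q(X)$ to the set of objects $D$ of $\mathbb{D}$ with $\chi(D)=\sigma^\ast(X)$, with functorial action given by the unique cartesian lifts created by $\chi$. -}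

module Defs where

open import Level using (Level; _⊔_) renaming (suc to lsuc)
open import Data.Product using (Σ; Σ-syntax; _×_; _,_; proj₁; proj₂)
open import Relation.Binary.PropositionalEquality using (_≡_)
open import Axiom.UniquenessOfIdentityProofs using (UIP)
open import Function.Bundles using (_↔_; Inverse)

record Category (o h : Level) : Set (lsuc (o ⊔ h)) where
  infixr 9 _∘_
  field
    Obj    : Set o
    Hom    : Obj → Obj → Set h
    id     : ∀ {A} → Hom A A
    _∘_    : ∀ {A B C} → Hom B C → Hom A B → Hom A C
    idˡ    : ∀ {A B} (f : Hom A B) → id ∘ f ≡ f
    idʳ    : ∀ {A B} (f : Hom A B) → f ∘ id ≡ f
    assoc  : ∀ {A B C D} (h : Hom C D) (g : Hom B C) (f : Hom A B) →
             (h ∘ g) ∘ f ≡ h ∘ (g ∘ f)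
    Obj-set : UIP Obj
    Hom-set : ∀ A B → UIP (Hom A B)

open Category public

-- Heterogeneous equality of morphisms of the same category whose
-- (co)domains are not definitionally equal; f ≋ g forces the domains,
-- the codomains and the morphisms to be equal.
data HomEq {o h} (C : Category o h) {A B : Obj C} (f : Hom C A B)
  : {A' B' : Obj C} → Hom C A' B' → Set (o ⊔ h) where
  ≋-refl : HomEq C f f

record Functor {o₁ h₁ o₂ h₂} (C : Category o₁ h₁) (D : Category o₂ h₂)
  : Set (o₁ ⊔ h₁ ⊔ o₂ ⊔ h₂) where
  field
    F₀    : Obj C → Obj D
    F₁    : ∀ {A B} → Hom C A B → Hom D (F₀ A) (F₀ B)
    F-id  : ∀ {A} → F₁ (id C {A}) ≡ id D
    F-∘   : ∀ {A B E} (g : Hom C B E) (f : Hom C A B) →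
            F₁ (_∘_ C g f) ≡ _∘_ D (F₁ g) (F₁ f)

open Functor public

module _ {o₁ h₁ o₂ h₂} {𝔻 : Category o₁ h₁} {𝔹 : Category o₂ h₂}
         (P : Functor 𝔻 𝔹) where

  IsCartesian : ∀ {Y X} → Hom 𝔻 Y X → Set (o₁ ⊔ h₁ ⊔ h₂)
  IsCartesian {Y} {X} f =
    ∀ {Z} (g : Hom 𝔻 Z X) (u : Hom 𝔹 (F₀ P Z) (F₀ P Y)) →
    F₁ P g ≡ _∘_ 𝔹 (F₁ P f) u →
    Σ[ k ∈ Hom 𝔻 Z Y ] ((F₁ P k ≡ u × _∘_ 𝔻 f k ≡ g) ×
      (∀ (k' : Hom 𝔻 Z Y) → F₁ P k' ≡ u → _∘_ 𝔻 f k' ≡ g → k' ≡ k))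

  record Fibration : Set (o₁ ⊔ h₁ ⊔ o₂ ⊔ h₂) where
    field
      reindex   : ∀ {J} (X : Obj 𝔻) (σ : Hom 𝔹 J (F₀ P X)) → Obj 𝔻
      lift      : ∀ {J} (X : Obj 𝔻) (σ : Hom 𝔹 J (F₀ P X)) → Hom 𝔻 (reindex X σ) X
      lift-over : ∀ {J} (X : Obj 𝔻) (σ : Hom 𝔹 J (F₀ P X)) → HomEq 𝔹 (F₁ P (lift X σ)) σ
      lift-cart : ∀ {J} (X : Obj 𝔻) (σ : Hom 𝔹 J (F₀ P X)) → IsCartesian (lift X σ)

open Fibration public

module _ {o h} (𝔹 : Category o h) where

  IsPullback : ∀ {I J K P} (σ : Hom 𝔹 J I) (τ : Hom 𝔹 K I)
               (π₁ : Hom 𝔹 P J) (π₂ : Hom 𝔹 P K) → Set (o ⊔ h)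
  IsPullback {I} {J} {K} {P} σ τ π₁ π₂ =
    (_∘_ 𝔹 σ π₁ ≡ _∘_ 𝔹 τ π₂) ×
    (∀ {Q} (a : Hom 𝔹 Q J) (b : Hom 𝔹 Q K) → _∘_ 𝔹 σ a ≡ _∘_ 𝔹 τ b →
      Σ[ k ∈ Hom 𝔹 Q P ] ((_∘_ 𝔹 π₁ k ≡ a × _∘_ 𝔹 π₂ k ≡ b) ×
        (∀ (k' : Hom 𝔹 Q P) → _∘_ 𝔹 π₁ k' ≡ a → _∘_ 𝔹 π₂ k' ≡ b → k' ≡ k)))

  HasPullbacks : Set (o ⊔ h)
  HasPullbacks = ∀ {I J K} (σ : Hom 𝔹 J I) (τ : Hom 𝔹 K I) →
    Σ[ P ∈ Obj 𝔹 ] Σ[ π₁ ∈ Hom 𝔹 P J ] Σ[ π₂ ∈ Hom 𝔹 P K ] IsPullback σ τ π₁ π₂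

  SliceHom : ∀ {I J K} (σ : Hom 𝔹 J I) (τ : Hom 𝔹 K I) → Set h
  SliceHom {K = K} σ τ = Σ[ g ∈ Hom 𝔹 _ K ] (_∘_ 𝔹 τ g ≡ σ)

module _ {o₁ h₁ o₂ h₂ o₃ h₃}
         {𝔻 : Category o₁ h₁} {𝔼 : Category o₂ h₂} {𝔹 : Category o₃ h₃}
         (p : Functor 𝔻 𝔹) (q : Functor 𝔼 𝔹) (χ : Functor 𝔻 𝔼) where

  record IsFibred : Set (o₁ ⊔ h₁ ⊔ o₂ ⊔ h₂ ⊔ o₃ ⊔ h₃) where
    field
      over₀     : ∀ (D : Obj 𝔻) → F₀ q (F₀ χ D) ≡ F₀ p D
      over₁     : ∀ {D D'} (f : Hom 𝔻 D D') → HomEq 𝔹 (F₁ q (F₁ χ f)) (F₁ p f)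
      pres-cart : ∀ {D D'} (f : Hom 𝔻 D D') → IsCartesian p f → IsCartesian q (F₁ χ f)

  -- Cart(χ) : Cart(𝔻) → Cart(𝔼) is a discrete fibration: every cartesian
  -- u : X' → χ D has a unique cartesian f : D' → D (as a pair (D' , f))
  -- with χ f = u.
  CreatesCartesianLifts : Set (o₁ ⊔ h₁ ⊔ o₂ ⊔ h₂ ⊔ h₃)
  CreatesCartesianLifts =
    ∀ (D : Obj 𝔻) {X'} (u : Hom 𝔼 X' (F₀ χ D)) → IsCartesian q u →
    Σ[ L ∈ Σ[ D' ∈ Obj 𝔻 ] Hom 𝔻 D' D ]
      ((IsCartesian p (proj₂ L) × HomEq 𝔼 (F₁ χ (proj₂ L)) u) ×
       (∀ (L' : Σ[ D'' ∈ Obj 𝔻 ] Hom 𝔻 D'' D) →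
          IsCartesian p (proj₂ L') → HomEq 𝔼 (F₁ χ (proj₂ L')) u → L' ≡ L))

  module _ (qF : Fibration q) (X : Obj 𝔼) where

    χ̄₀ : ∀ {J} (σ : Hom 𝔹 J (F₀ q X)) → Set (o₁ ⊔ o₂)
    χ̄₀ σ = Σ[ D ∈ Obj 𝔻 ] (F₀ χ D ≡ reindex qF X σ)

    -- Graph of the functorial action of χ̄_X:  for ρ : (J',σ') → (J,σ) in B/qX,
    -- χ̄_X(ρ)(D) = D'  iff  D' → D is the (unique) cartesian lift created by χ
    -- of the canonical cartesian map u : σ'^* X → σ^* X over ρ
    -- (i.e. q u = ρ and lift_σ ∘ u = lift_σ').
    χ̄-acts : ∀ {J J'} (σ : Hom 𝔹 J (F₀ q X)) (σ' : Hom 𝔹 J' (F₀ q X))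
             (ρ : Hom 𝔹 J' J) → χ̄₀ σ → χ̄₀ σ' → Set _
    χ̄-acts σ σ' ρ (D , _) (D' , _) =
      Σ[ f ∈ Hom 𝔻 D' D ] (IsCartesian p f ×
        Σ[ u ∈ Hom 𝔼 (reindex qF X σ') (reindex qF X σ) ]
          (HomEq 𝔹 (F₁ q u) ρ ×
           _∘_ 𝔼 (lift qF X σ) u ≡ lift qF X σ' ×
           HomEq 𝔼 (F₁ χ f) u))

    RepresentedBy : ∀ {K} (τ : Hom 𝔹 K (F₀ q X)) → Set _
    RepresentedBy τ =
      Σ[ φ ∈ (∀ {J} (σ : Hom 𝔹 J (F₀ q X)) → SliceHom 𝔹 σ τ ↔ χ̄₀ σ) ]
        (∀ {J J'} (σ : Hom 𝔹 J (F₀ q X)) (σ' : Hom 𝔹 J' (F₀ q X))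
           (ρ : SliceHom 𝔹 σ' σ) (g : SliceHom 𝔹 σ τ) →
           χ̄-acts σ σ' (proj₁ ρ)
             (Inverse.to (φ σ) g)
             (Inverse.to (φ σ')
               ( _∘_ 𝔹 (proj₁ g) (proj₁ ρ)
               , trans-slice g ρ)))
      where
      open import Relation.Binary.PropositionalEquality using (trans; cong)
      trans-slice : ∀ {J J'} {σ : Hom 𝔹 J (F₀ q X)} {σ' : Hom 𝔹 J' (F₀ q X)}
                    (g : SliceHom 𝔹 σ τ) (ρ : SliceHom 𝔹 σ' σ) →
                    _∘_ 𝔹 τ (_∘_ 𝔹 (proj₁ g) (proj₁ ρ)) ≡ σ'
      trans-slice (g , eg) (r , er) =
        trans (Relation.Binary.PropositionalEquality.sym (assoc 𝔹 τ g r))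
              (trans (cong (λ x → _∘_ 𝔹 x r) eg) er)

    Representable : Set _
    Representable = Σ[ K ∈ Obj 𝔹 ] Σ[ τ ∈ Hom 𝔹 K (F₀ q X) ] RepresentedBy τ

{-# OPTIONS --safe #-}
-- Let ℓ : Y → X be the chosen cartesian lift of σ. For α : L → J the lifts α*Y → Y → X and
-- (σα)*X → X are both cartesian over σα, hence related by a vertical isomorphism in 𝔼;
-- as χ creates cartesian lifts, restricting along it identifies χ̄_X(σα) with χ̄_Y(α),
-- naturally in α. Composed with B/J(α, π₁) ≅ B/I(σα, τ), which is the universal property
-- of the pullback, the representation of χ̄_X becomes one of χ̄_Y by π₁ = σ*(τ).
module Submission where

open import Defs
open import Level using (Level; _⊔_)
open import Data.Product using (Σ; Σ-syntax; _×_; _,_; proj₁; proj₂)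
open import Relation.Binary.PropositionalEquality
open import Function.Bundles using (_↔_; Inverse; mk↔ₛ′)
open import Function.Construct.Composition using (_↔-∘_)

module _ {o h} {C : Category o h} where

  private
    infixr 9 _·_
    _·_ : ∀ {A B E} → Hom C B E → Hom C A B → Hom C A E
    _·_ = _∘_ C

  ≋-trans : ∀ {A B A' B' A'' B''} {f : Hom C A B} {g : Hom C A' B'} {k : Hom C A'' B''} →
            HomEq C f g → HomEq C g k → HomEq C f k
  ≋-trans ≋-refl ≋-refl = ≋-refl

  ≋⇒≡ : ∀ {A B} {f g : Hom C A B} → HomEq C f g → f ≡ g
  ≋⇒≡ ≋-refl = refl

  ≡⇒≋ : ∀ {A B} {f g : Hom C A B} → f ≡ g → HomEq C f g
  ≡⇒≋ refl = ≋-refl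

  ≋-dom : ∀ {A B A' B'} {f : Hom C A B} {g : Hom C A' B'} → HomEq C f g → A ≡ A'
  ≋-dom ≋-refl = refl

  ≋-∘ : ∀ {A B E A' B' E'} {f : Hom C A B} {g : Hom C B E} {f' : Hom C A' B'} {g' : Hom C B' E'} →
        HomEq C g g' → HomEq C f f' → HomEq C (_∘_ C g f) (_∘_ C g' f')
  ≋-∘ ≋-refl ≋-refl = ≋-refl

  ≋-id : ∀ {A A'} → A ≡ A' → HomEq C (id C {A}) (id C {A'})
  ≋-id refl = ≋-refl

  slice-≡ : ∀ {I J K} {σ : Hom C J I} {τ : Hom C K I} {g h : SliceHom C σ τ} →
            proj₁ g ≡ proj₁ h → g ≡ h
  slice-≡ {g = g , e} {.g , e'} refl = cong (g ,_) (Hom-set C _ _ e e')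

  pullback-slice↔ : ∀ {I J K P L} {σ : Hom C J I} {τ : Hom C K I} {π₁ : Hom C P J} {π₂ : Hom C P K} →
                    IsPullback C σ τ π₁ π₂ → (α : Hom C L J) →
                    SliceHom C α π₁ ↔ SliceHom C (σ · α) τ
  pullback-slice↔ {σ = σ} {τ} {π₁} {π₂} (square , universal) α = mk↔ₛ′ to from to-from from-to
    where
    to : SliceHom C α π₁ → SliceHom C (σ · α) τ
    to (g , π₁g≡α) = π₂ · g , (begin
      τ · π₂ · g    ≡⟨ sym (assoc C τ π₂ g) ⟩
      (τ · π₂) · g  ≡⟨ cong (_· g) (sym square) ⟩
      (σ · π₁) · g  ≡⟨ assoc C σ π₁ g ⟩
      σ · π₁ · g    ≡⟨ cong (σ ·_) π₁g≡α ⟩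
      σ · α         ∎)
      where open ≡-Reasoning
    from : SliceHom C (σ · α) τ → SliceHom C α π₁
    from (h , τh≡σα) = let (k , (π₁k≡α , _) , _) = universal α h (sym τh≡σα) in k , π₁k≡α
    to-from : ∀ h → to (from h) ≡ h
    to-from (h , τh≡σα) = slice-≡ (proj₂ (proj₁ (proj₂ (universal α h (sym τh≡σα)))))
    from-to : ∀ g → from (to g) ≡ g
    from-to (g , π₁g≡α) = slice-≡ (sym (proj₂ (proj₂ (universal α (π₂ · g) _)) g π₁g≡α refl))

  isPullback-≋ : ∀ {I J J' K P} {σ : Hom C J I} {σ' : Hom C J' I} {τ : Hom C K I}
                 {π₁ : Hom C P J} {π₂ : Hom C P K} → HomEq C σ' σ → IsPullback C σ τ π₁ π₂ →
                 Σ[ π₁' ∈ Hom C P J' ] (HomEq C π₁' π₁ × IsPullback C σ' τ π₁' π₂)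
  isPullback-≋ ≋-refl pb = _ , ≋-refl , pb

module Cartesian {o₁ h₁ o₂ h₂} {𝔻 : Category o₁ h₁} {𝔹 : Category o₂ h₂} (P : Functor 𝔻 𝔹) where
  private
    infixr 9 _∙_ _·_
    _∙_ : ∀ {A B E} → Hom 𝔻 B E → Hom 𝔻 A B → Hom 𝔻 A E
    _∙_ = _∘_ 𝔻
    _·_ : ∀ {A B E} → Hom 𝔹 B E → Hom 𝔹 A B → Hom 𝔹 A E
    _·_ = _∘_ 𝔹

  cartesian-id : ∀ {A} → IsCartesian P (id 𝔻 {A})
  cartesian-id g u Pg≡id·u =
    g , (trans (trans Pg≡id·u (cong (_· u) (F-id P))) (idˡ 𝔹 u) , idˡ 𝔻 g) ,
    λ k _ id∙k≡g → trans (sym (idˡ 𝔻 k)) id∙k≡g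

  cartesian-∘ : ∀ {A B E} {f : Hom 𝔻 A B} {g : Hom 𝔻 B E} →
                IsCartesian P f → IsCartesian P g → IsCartesian P (g ∙ f)
  cartesian-∘ {f = f} {g} f-cart g-cart h u Ph≡Pgf·u =
    k , (Pk≡u , g∙f∙k≡h) , unique
    where
    Ph≡Pg·Pf·u : F₁ P h ≡ F₁ P g · F₁ P f · u
    Ph≡Pg·Pf·u = trans Ph≡Pgf·u (trans (cong (_· u) (F-∘ P g f)) (assoc 𝔹 _ _ _))
    through-g = g-cart h (F₁ P f · u) Ph≡Pg·Pf·u
    k₁ = proj₁ through-g
    through-f = f-cart k₁ u (proj₁ (proj₁ (proj₂ through-g)))
    k = proj₁ through-f
    Pk≡u = proj₁ (proj₁ (proj₂ through-f))
    g∙f∙k≡h : (g ∙ f) ∙ k ≡ h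
    g∙f∙k≡h = trans (assoc 𝔻 g f k)
                (trans (cong (g ∙_) (proj₂ (proj₁ (proj₂ through-f)))) (proj₂ (proj₁ (proj₂ through-g))))
    unique : ∀ k' → F₁ P k' ≡ u → (g ∙ f) ∙ k' ≡ h → k' ≡ k
    unique k' Pk'≡u gfk'≡h = proj₂ (proj₂ through-f) k' Pk'≡u
      (proj₂ (proj₂ through-g) (f ∙ k')
        (trans (F-∘ P f k') (cong (F₁ P f ·_) Pk'≡u))
        (trans (sym (assoc 𝔻 g f k')) gfk'≡h))

  cartesian-cancelˡ : ∀ {A B E} {c : Hom 𝔻 B E} {v : Hom 𝔻 A B} {g : Hom 𝔻 A E} →
                      IsCartesian P c → IsCartesian P g → c ∙ v ≡ g → IsCartesian P v
  cartesian-cancelˡ {c = c} {v} c-cart g-cart refl h u Ph≡Pv·u = k , (Pk≡u , v∙k≡h) , unique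
    where
    Pch≡Pcv·u : F₁ P (c ∙ h) ≡ F₁ P (c ∙ v) · u
    Pch≡Pcv·u = trans (F-∘ P c h) (trans (cong (F₁ P c ·_) Ph≡Pv·u)
                  (trans (sym (assoc 𝔹 _ _ _)) (cong (_· u) (sym (F-∘ P c v)))))
    through-cv = g-cart (c ∙ h) u Pch≡Pcv·u
    k = proj₁ through-cv
    Pk≡u = proj₁ (proj₁ (proj₂ through-cv))
    through-c-unique = proj₂ (proj₂ (c-cart (c ∙ h) (F₁ P h) (F-∘ P c h)))
    -- both v ∙ k and h factor c ∙ h through c over P h
    v∙k≡h : v ∙ k ≡ h
    v∙k≡h = trans
      (through-c-unique (v ∙ k) (trans (F-∘ P v k) (trans (cong (F₁ P v ·_) Pk≡u) (sym Ph≡Pv·u)))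
        (trans (sym (assoc 𝔻 c v k)) (proj₂ (proj₁ (proj₂ through-cv)))))
      (sym (through-c-unique h refl refl))
    unique : ∀ k' → F₁ P k' ≡ u → v ∙ k' ≡ h → k' ≡ k
    unique k' Pk'≡u vk'≡h = proj₂ (proj₂ through-cv) k' Pk'≡u (trans (assoc 𝔻 c v k') (cong (c ∙_) vk'≡h))

  -- Base maps are matched only up to ≋, as chosen lifts lie over their base map only up to ≋.
  cartesian-factor : ∀ {W X V} {c : Hom 𝔻 W X} → IsCartesian P c →
    ∀ {A B I} {β : Hom 𝔹 B I} → HomEq 𝔹 (F₁ P c) β →
    {g : Hom 𝔻 V X} {γ : Hom 𝔹 A I} → HomEq 𝔹 (F₁ P g) γ →
    (b : Hom 𝔹 A B) → β · b ≡ γ →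
    Σ[ k ∈ Hom 𝔻 V W ] ((HomEq 𝔹 (F₁ P k) b × c ∙ k ≡ g) ×
      (∀ k' → HomEq 𝔹 (F₁ P k') b → c ∙ k' ≡ g → k' ≡ k))
  cartesian-factor c-cart ≋-refl ≋-refl b β·b≡γ =
    let (k , (Pk≡b , ck≡g) , unique) = c-cart _ b (sym β·b≡γ)
    in k , (≡⇒≋ Pk≡b , ck≡g) , λ k' Pk'≋b → unique k' (≋⇒≡ Pk'≋b)

  module _ {A B X L I} {a : Hom 𝔻 A X} {b : Hom 𝔻 B X} {β : Hom 𝔹 L I}
           (a-cart : IsCartesian P a) (a-over : HomEq 𝔹 (F₁ P a) β) (b-over : HomEq 𝔹 (F₁ P b) β) where

    private
      factor = cartesian-factor a-cart a-over b-over (id 𝔹) (idʳ 𝔹 β)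

    comparison : Hom 𝔻 B A
    comparison = proj₁ factor

    comparison-vertical : HomEq 𝔹 (F₁ P comparison) (id 𝔹 {L})
    comparison-vertical = proj₁ (proj₁ (proj₂ factor))

    comparison-commutes : a ∙ comparison ≡ b
    comparison-commutes = proj₂ (proj₁ (proj₂ factor))

    comparison-cartesian : IsCartesian P b → IsCartesian P comparison
    comparison-cartesian b-cart = cartesian-cancelˡ a-cart b-cart comparison-commutes

  comparison-inverse : ∀ {A B X L I} {a : Hom 𝔻 A X} {b : Hom 𝔻 B X} {β : Hom 𝔹 L I}
    (a-cart : IsCartesian P a) (b-cart : IsCartesian P b)
    (a-over : HomEq 𝔹 (F₁ P a) β) (b-over : HomEq 𝔹 (F₁ P b) β) →
    comparison a-cart a-over b-over ∙ comparison b-cart b-over a-over ≡ id 𝔻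
  comparison-inverse {a = a} {β = β} a-cart b-cart a-over b-over =
    trans (unique (v ∙ w) v∙w-vertical a∙v∙w≡a) (sym (unique (id 𝔻) id-vertical (idʳ 𝔻 a)))
    where
    v = comparison a-cart a-over b-over
    w = comparison b-cart b-over a-over
    unique = proj₂ (proj₂ (cartesian-factor a-cart a-over a-over (id 𝔹) (idʳ 𝔹 β)))
    v∙w-vertical : HomEq 𝔹 (F₁ P (v ∙ w)) (id 𝔹)
    v∙w-vertical = ≋-trans (≡⇒≋ (F-∘ P v w))
      (≋-trans (≋-∘ (comparison-vertical a-cart a-over b-over) (comparison-vertical b-cart b-over a-over))
               (≡⇒≋ (idˡ 𝔹 _)))
    a∙v∙w≡a : a ∙ v ∙ w ≡ a
    a∙v∙w≡a = trans (sym (assoc 𝔻 _ _ _))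
      (trans (cong (_∙ w) (comparison-commutes a-cart a-over b-over)) (comparison-commutes b-cart b-over a-over))
    id-vertical : HomEq 𝔹 (F₁ P (id 𝔻)) (id 𝔹)
    id-vertical = ≋-trans (≡⇒≋ (F-id P)) (≋-id (≋-dom a-over))

module Creation {o₁ h₁ o₂ h₂ o₃ h₃}
  {𝔻 : Category o₁ h₁} {𝔼 : Category o₂ h₂} {𝔹 : Category o₃ h₃}
  (p : Functor 𝔻 𝔹) (q : Functor 𝔼 𝔹) (χ : Functor 𝔻 𝔼)
  (creates : CreatesCartesianLifts p q χ) where

  private
    _∘𝔼_ : ∀ {A B E} → Hom 𝔼 B E → Hom 𝔼 A B → Hom 𝔼 A E
    _∘𝔼_ = _∘_ 𝔼

  Preimage : Obj 𝔼 → Set (o₁ ⊔ o₂)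
  Preimage E = Σ[ D ∈ Obj 𝔻 ] (F₀ χ D ≡ E)

  preimage-≡ : ∀ {E} {x y : Preimage E} → proj₁ x ≡ proj₁ y → x ≡ y
  preimage-≡ {x = D , e} {.D , e'} refl = cong (D ,_) (Obj-set 𝔼 e e')

  CartesianLift : ∀ {W E} → Hom 𝔼 W E → Obj 𝔻 → Obj 𝔻 → Set (h₁ ⊔ o₁ ⊔ h₃ ⊔ o₂ ⊔ h₂)
  CartesianLift u D' D = Σ[ f ∈ Hom 𝔻 D' D ] (IsCartesian p f × HomEq 𝔼 (F₁ χ f) u)

  cartesianLift-id : ∀ {E} (x : Preimage E) → CartesianLift (id 𝔼 {E}) (proj₁ x) (proj₁ x)
  cartesianLift-id (D , χD≡E) = id 𝔻 , Cartesian.cartesian-id p , ≋-trans (≡⇒≋ (F-id χ)) (≋-id χD≡E)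

  cartesianLift-∘ : ∀ {A B E D₀ D₁ D₂} {u : Hom 𝔼 B E} {v : Hom 𝔼 A B} →
                    CartesianLift u D₁ D₀ → CartesianLift v D₂ D₁ → CartesianLift (u ∘𝔼 v) D₂ D₀
  cartesianLift-∘ (f , f-cart , χf≋u) (g , g-cart , χg≋v) =
    _∘_ 𝔻 f g , Cartesian.cartesian-∘ p g-cart f-cart , ≋-trans (≡⇒≋ (F-∘ χ f g)) (≋-∘ χf≋u χg≋v)

  cartesianLift-unique : ∀ {W E D D₁ D₂} {u : Hom 𝔼 W E} → IsCartesian q u →
                         CartesianLift u D₁ D → CartesianLift u D₂ D → D₁ ≡ D₂
  cartesianLift-unique {D = D} u-cart (f₁ , f₁-cart , ≋-refl) (f₂ , f₂-cart , χf₂≋u) =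
    cong proj₁ (trans (unique (_ , f₁) f₁-cart ≋-refl) (sym (unique (_ , f₂) f₂-cart χf₂≋u)))
    where unique = proj₂ (proj₂ (creates D (F₁ χ f₁) u-cart))

  created : ∀ {W E} (u : Hom 𝔼 W E) → IsCartesian q u →
            (x : Preimage E) → Σ[ D' ∈ Obj 𝔻 ] CartesianLift u D' (proj₁ x)
  created u u-cart (D , refl) =
    let ((D' , f) , (f-cart , χf≋u) , _) = creates D u u-cart in D' , f , f-cart , χf≋u

  restrict : ∀ {W E} (u : Hom 𝔼 W E) → IsCartesian q u → Preimage E → Preimage W
  restrict u u-cart x =
    let (D' , _ , _ , χf≋u) = created u u-cart x in D' , ≋-dom χf≋u

  restrict-lift : ∀ {W E} (u : Hom 𝔼 W E) (u-cart : IsCartesian q u) (x : Preimage E) →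
                  CartesianLift u (proj₁ (restrict u u-cart x)) (proj₁ x)
  restrict-lift u u-cart x = proj₂ (created u u-cart x)

  restrict-inverse : ∀ {W E} (u : Hom 𝔼 W E) (u-cart : IsCartesian q u)
                     (v : Hom 𝔼 E W) (v-cart : IsCartesian q v) →
                     u ∘𝔼 v ≡ id 𝔼 → ∀ x → restrict v v-cart (restrict u u-cart x) ≡ x
  restrict-inverse u u-cart v v-cart u∘v≡id x = preimage-≡
    (cartesianLift-unique (Cartesian.cartesian-id q)
      (subst (λ w → CartesianLift w (proj₁ y) (proj₁ x)) u∘v≡id
        (cartesianLift-∘ (restrict-lift u u-cart x) (restrict-lift v v-cart (restrict u u-cart x))))
      (cartesianLift-id x))
    where y = restrict v v-cart (restrict u u-cart x)

  restrict-↔ : ∀ {W E} (u : Hom 𝔼 W E) (u-cart : IsCartesian q u)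
               (v : Hom 𝔼 E W) (v-cart : IsCartesian q v) →
               u ∘𝔼 v ≡ id 𝔼 → v ∘𝔼 u ≡ id 𝔼 → Preimage E ↔ Preimage W
  restrict-↔ u u-cart v v-cart u∘v≡id v∘u≡id = mk↔ₛ′ (restrict u u-cart) (restrict v v-cart)
    (restrict-inverse v v-cart u u-cart v∘u≡id) (restrict-inverse u u-cart v v-cart u∘v≡id)

module Reindexing {o₁ h₁ o₂ h₂ o₃ h₃}
  {𝔻 : Category o₁ h₁} {𝔼 : Category o₂ h₂} {𝔹 : Category o₃ h₃}
  (p : Functor 𝔻 𝔹) (q : Functor 𝔼 𝔹) (χ : Functor 𝔻 𝔼)
  (creates : CreatesCartesianLifts p q χ) (qF : Fibration q)
  {X Y : Obj 𝔼} {ℓ : Hom 𝔼 Y X} (ℓ-cart : IsCartesian q ℓ) where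

  open Creation p q χ creates
  open Cartesian q
  private
    infixr 9 _∘𝔼_ _·_
    _∘𝔼_ : ∀ {A B E} → Hom 𝔼 B E → Hom 𝔼 A B → Hom 𝔼 A E
    _∘𝔼_ = _∘_ 𝔼
    _·_ : ∀ {A B E} → Hom 𝔹 B E → Hom 𝔹 A B → Hom 𝔹 A E
    _·_ = _∘_ 𝔹
    σ = F₁ q ℓ

  module _ {L} (α : Hom 𝔹 L (F₀ q Y)) where

    private
      lift-σα-cart : IsCartesian q (lift qF X (σ · α))
      lift-σα-cart = lift-cart qF X (σ · α)
      lift-σα-over : HomEq 𝔹 (F₁ q (lift qF X (σ · α))) (σ · α)
      lift-σα-over = lift-over qF X (σ · α)

    ℓ∘lift-over : HomEq 𝔹 (F₁ q (ℓ ∘𝔼 lift qF Y α)) (σ · α)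
    ℓ∘lift-over = ≋-trans (≡⇒≋ (F-∘ q ℓ _)) (≋-∘ ≋-refl (lift-over qF Y α))

    ℓ∘lift-cart : IsCartesian q (ℓ ∘𝔼 lift qF Y α)
    ℓ∘lift-cart = cartesian-∘ (lift-cart qF Y α) ℓ-cart

    reindex-comparison : Hom 𝔼 (reindex qF Y α) (reindex qF X (σ · α))
    reindex-comparison = comparison lift-σα-cart lift-σα-over ℓ∘lift-over

    reindex-comparison-vertical : HomEq 𝔹 (F₁ q reindex-comparison) (id 𝔹 {L})
    reindex-comparison-vertical = comparison-vertical lift-σα-cart lift-σα-over ℓ∘lift-over

    reindex-comparison-commutes : lift qF X (σ · α) ∘𝔼 reindex-comparison ≡ ℓ ∘𝔼 lift qF Y α
    reindex-comparison-commutes = comparison-commutes lift-σα-cart lift-σα-over ℓ∘lift-over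

    reindex-comparison-cart : IsCartesian q reindex-comparison
    reindex-comparison-cart =
      comparison-cartesian lift-σα-cart lift-σα-over ℓ∘lift-over ℓ∘lift-cart

    χ̄-reindex-↔ : χ̄₀ p q χ qF X (σ · α) ↔ χ̄₀ p q χ qF Y α
    χ̄-reindex-↔ = restrict-↔ reindex-comparison reindex-comparison-cart
      (comparison ℓ∘lift-cart ℓ∘lift-over lift-σα-over)
      (comparison-cartesian ℓ∘lift-cart ℓ∘lift-over lift-σα-over lift-σα-cart)
      (comparison-inverse lift-σα-cart ℓ∘lift-cart lift-σα-over ℓ∘lift-over)
      (comparison-inverse ℓ∘lift-cart lift-σα-cart ℓ∘lift-over lift-σα-over)

  χ̄-acts-reindex : ∀ {L L'} (α : Hom 𝔹 L (F₀ q Y)) (α' : Hom 𝔹 L' (F₀ q Y)) (r : Hom 𝔹 L' L) →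
    α · r ≡ α' → ∀ x x' → χ̄-acts p q χ qF X (σ · α) (σ · α') r x x' →
    χ̄-acts p q χ qF Y α α' r (Inverse.to (χ̄-reindex-↔ α) x) (Inverse.to (χ̄-reindex-↔ α') x')
  χ̄-acts-reindex α α' r α·r≡α' x@(D , _) x'@(_ , _) (fX , fX-cart , uX , uX-over , uX-commutes , χfX≋uX) =
    let (f , f-cart , χf≋uY) = subst (λ E → CartesianLift uY E (proj₁ y)) E≡D'Y (proj₂ uY-lift)
    in f , f-cart , uY , uY-over , uY-commutes , χf≋uY
    where
    v = reindex-comparison α
    v' = reindex-comparison α'
    y = Inverse.to (χ̄-reindex-↔ α) x
    y' = Inverse.to (χ̄-reindex-↔ α') x'
    uY-factor = cartesian-factor (lift-cart qF Y α) (lift-over qF Y α) (lift-over qF Y α') r α·r≡α'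
    uY = proj₁ uY-factor
    uY-over = proj₁ (proj₁ (proj₂ uY-factor))
    uY-commutes = proj₂ (proj₁ (proj₂ uY-factor))
    uY-cart : IsCartesian q uY
    uY-cart = cartesian-cancelˡ (lift-cart qF Y α) (lift-cart qF Y α') uY-commutes
    σα·r≡σα' : (σ · α) · r ≡ σ · α'
    σα·r≡σα' = trans (assoc 𝔹 σ α r) (cong (σ ·_) α·r≡α')
    -- both composites factor ℓ ∘ lift α' through the lift of σ · α over r
    v∘uY≡uX∘v' : v ∘𝔼 uY ≡ uX ∘𝔼 v'
    v∘uY≡uX∘v' = trans (unique _ v∘uY-over v∘uY-commutes) (sym (unique _ uX∘v'-over uX∘v'-commutes))
      where
      unique = proj₂ (proj₂ (cartesian-factor (lift-cart qF X (σ · α)) (lift-over qF X (σ · α))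
                                              (ℓ∘lift-over α') r σα·r≡σα'))
      v∘uY-over : HomEq 𝔹 (F₁ q (v ∘𝔼 uY)) r
      v∘uY-over = ≋-trans (≡⇒≋ (F-∘ q v uY))
        (≋-trans (≋-∘ (reindex-comparison-vertical α) uY-over) (≡⇒≋ (idˡ 𝔹 r)))
      v∘uY-commutes : lift qF X (σ · α) ∘𝔼 v ∘𝔼 uY ≡ ℓ ∘𝔼 lift qF Y α'
      v∘uY-commutes = begin
        lift qF X (σ · α) ∘𝔼 v ∘𝔼 uY    ≡⟨ sym (assoc 𝔼 _ _ _) ⟩
        (lift qF X (σ · α) ∘𝔼 v) ∘𝔼 uY  ≡⟨ cong (_∘𝔼 uY) (reindex-comparison-commutes α) ⟩
        (ℓ ∘𝔼 lift qF Y α) ∘𝔼 uY        ≡⟨ assoc 𝔼 _ _ _ ⟩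
        ℓ ∘𝔼 lift qF Y α ∘𝔼 uY          ≡⟨ cong (ℓ ∘𝔼_) uY-commutes ⟩
        ℓ ∘𝔼 lift qF Y α'               ∎
        where open ≡-Reasoning
      uX∘v'-over : HomEq 𝔹 (F₁ q (uX ∘𝔼 v')) r
      uX∘v'-over = ≋-trans (≡⇒≋ (F-∘ q uX v'))
        (≋-trans (≋-∘ uX-over (reindex-comparison-vertical α')) (≡⇒≋ (idʳ 𝔹 r)))
      uX∘v'-commutes : lift qF X (σ · α) ∘𝔼 uX ∘𝔼 v' ≡ ℓ ∘𝔼 lift qF Y α'
      uX∘v'-commutes = trans (sym (assoc 𝔼 _ _ _))
        (trans (cong (_∘𝔼 v') uX-commutes) (reindex-comparison-commutes α'))
    uY-lift = created uY uY-cart y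
    E≡D'Y : proj₁ uY-lift ≡ proj₁ y'
    E≡D'Y = cartesianLift-unique (cartesian-∘ uY-cart (reindex-comparison-cart α))
      (cartesianLift-∘ (restrict-lift v (reindex-comparison-cart α) x) (proj₂ uY-lift))
      (subst (λ w → CartesianLift w (proj₁ y') D) (sym v∘uY≡uX∘v')
        (cartesianLift-∘ (fX , fX-cart , χfX≋uX) (restrict-lift v' (reindex-comparison-cart α') x')))

  representedBy-pullback : ∀ {K P} {τ : Hom 𝔹 K (F₀ q X)} {π₁ : Hom 𝔹 P (F₀ q Y)} {π₂ : Hom 𝔹 P K} →
    IsPullback 𝔹 σ τ π₁ π₂ → RepresentedBy p q χ qF X τ → RepresentedBy p q χ qF Y π₁
  representedBy-pullback {P = P} {π₁ = π₁} {π₂} pb (φ , φ-natural) =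
    φY , λ { α α' (r , α·r≡α') (g , π₁g≡α) → φY-natural α α' r α·r≡α' g π₁g≡α _ }
    where
    φY : ∀ {L} (α : Hom 𝔹 L (F₀ q Y)) → SliceHom 𝔹 α π₁ ↔ χ̄₀ p q χ qF Y α
    φY α = χ̄-reindex-↔ α ↔-∘ (φ (σ · α) ↔-∘ pullback-slice↔ {C = 𝔹} pb α)

    φY-natural : ∀ {L L'} (α : Hom 𝔹 L (F₀ q Y)) (α' : Hom 𝔹 L' (F₀ q Y)) (r : Hom 𝔹 L' L) →
      (α·r≡α' : α · r ≡ α') (g : Hom 𝔹 L P) (π₁g≡α : π₁ · g ≡ α) (π₁gr≡α' : π₁ · g · r ≡ α') →
      χ̄-acts p q χ qF Y α α' r (Inverse.to (φY α) (g , π₁g≡α)) (Inverse.to (φY α') (g · r , π₁gr≡α'))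
    φY-natural α α' r α·r≡α' g π₁g≡α π₁gr≡α' =
      χ̄-acts-reindex α α' r α·r≡α' (Inverse.to (φ (σ · α)) h) (Inverse.to (φ (σ · α')) h')
        (subst (λ k → χ̄-acts p q χ qF X (σ · α) (σ · α') r
                              (Inverse.to (φ (σ · α)) h) (Inverse.to (φ (σ · α')) k))
               (slice-≡ {C = 𝔹} (assoc 𝔹 π₂ g r))
               (φ-natural (σ · α) (σ · α') (r , trans (assoc 𝔹 σ α r) (cong (σ ·_) α·r≡α')) h))
      where
      h = Inverse.to (pullback-slice↔ {C = 𝔹} pb α) (g , π₁g≡α)
      h' = Inverse.to (pullback-slice↔ {C = 𝔹} pb α') (g · r , π₁gr≡α')

mainTheorem17 : ∀ {o₁ h₁ o₂ h₂ o₃ h₃ : Level}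
    {𝔻 : Category o₁ h₁} {𝔼 : Category o₂ h₂} {𝔹 : Category o₃ h₃}
    (p : Functor 𝔻 𝔹) (q : Functor 𝔼 𝔹) →
    Fibration p → (qF : Fibration q) → HasPullbacks 𝔹 →
    (χ : Functor 𝔻 𝔼) → IsFibred p q χ → CreatesCartesianLifts p q χ →
    (X : Obj 𝔼) → Representable p q χ qF X →
    ((∀ {J} (σ : Hom 𝔹 J (F₀ q X)) → Representable p q χ qF (reindex qF X σ))
    × (∀ {K} (τ : Hom 𝔹 K (F₀ q X)) → RepresentedBy p q χ qF X τ →
         ∀ {J P} (σ : Hom 𝔹 J (F₀ q X)) (π₁ : Hom 𝔹 P J) (π₂ : Hom 𝔹 P K) →
         IsPullback 𝔹 σ τ π₁ π₂ →
         Σ[ τ' ∈ Hom 𝔹 P (F₀ q (reindex qF X σ)) ]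
           (HomEq 𝔹 τ' π₁ × RepresentedBy p q χ qF (reindex qF X σ) τ')))
mainTheorem17 {𝔹 = 𝔹} p q _ qF pullbacks χ _ creates X (_ , τ₀ , represented) =
  reindex-representable , reindex-representedBy
  where
  reindex-representedBy : ∀ {K} (τ : Hom 𝔹 K (F₀ q X)) → RepresentedBy p q χ qF X τ →
    ∀ {J P} (σ : Hom 𝔹 J (F₀ q X)) (π₁ : Hom 𝔹 P J) (π₂ : Hom 𝔹 P K) →
    IsPullback 𝔹 σ τ π₁ π₂ →
    Σ[ τ' ∈ Hom 𝔹 P (F₀ q (reindex qF X σ)) ]
      (HomEq 𝔹 τ' π₁ × RepresentedBy p q χ qF (reindex qF X σ) τ')
  reindex-representedBy τ rep σ π₁ π₂ pb =
    let (τ' , τ'≋π₁ , pb') = isPullback-≋ (lift-over qF X σ) pb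
    in τ' , τ'≋π₁ , Reindexing.representedBy-pullback p q χ creates qF (lift-cart qF X σ) pb' rep

  reindex-representable : ∀ {J} (σ : Hom 𝔹 J (F₀ q X)) → Representable p q χ qF (reindex qF X σ)
  reindex-representable σ =
    let (P , π₁ , π₂ , pb) = pullbacks σ τ₀
        (τ' , _ , rep') = reindex-representedBy τ₀ represented σ π₁ π₂ pb
    in P , τ' , rep'
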